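{- Let $P$ be a naturally labeled poset on $\{1,\ldots,n\}$ and let $C_1,\ldots,C_h$ be the connected components of the graph $G_P$. Let $1\le r\le h$ and let $M_r$ be a maximum independent set of $C_r$. Then for any two maximum independent sets $M^1,M^2$ of $G_P$ with $M^1\cap V(C_r)=M^2\cap V(C_r)=M_r$, we have $\mathrm{Des}(M_r,M^1)=\mathrm{Des}(M_r,M^2)$ and $\overline{\mathrm{Des}}(M_r,M^1)=\overline{\mathrm{Des}}(M_r,M^2)$.
   Context: $P$ is a partial order $\leq_P$ on $[n]=\{1,\ldots,n\}$; it is naturally labeled if $i<_P j$ implies $i<j$. An order ideal is a subset $J$ with $i\in J$, $j\leq_P i\Rightarrow j\in J$; a nonempty order ideal is connected if the Hasse diagram of $P$ restricted to it is connected. Sets $A,B$ intersect nontrivially if $A\cap B\ne\emptyset$, $A\not\subseteq B$, $B\not\subseteq A$. $G_P$ is the simple graph whose vertices are the connected order ideals of $P$, adjacent iff they intersect nontrivially; $V(C)$ denotes the vertex set of a subgraph $C$. A maximum independent set is an independent set (pairwise non-adjacent vertices) of largest possible size. For a maximum independent set $M$ of $G_P$ and $J\in M$ let $\mu(M,J)=\bigcup_{J'\in M,\,J'\subsetneq J}J'$. It is a fact (established in the paper) that for each $J\in M$, $J\setminus\mu(M,J)$ is a single element and distinct $J\in M$ give distinct elements, so each $i\in[n]$ corresponds to a unique $J_i\in M$ with $J_i\setminus\mu(M,J_i)=\{i\}$. Let $F_M$ be the poset on $[n]$ with $i<_{F_M}j$ iff $J_i\subsetneq J_j$; it is a forest (each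 element covered by at most one element, called its parent). For a forest $F$ on $[n]$, $\mathrm{Des}(F)=\{i : \text{the parent } j \text{ of } i \text{ satisfies } i>j\}$. Set $\mathrm{Des}(M)=\mathrm{Des}(F_M)$. For a maximum independent set $M_r$ of $C_r$ and a maximum independent set $M$ of $G_P$ with $M\cap V(C_r)=M_r$, define $\mathrm{Des}(M_r,M)=\{i\in\mathrm{Des}(M) : \{i\}=J\setminus\mu(M,J)\text{ for some }J\in M_r\}$ and $\overline{\mathrm{Des}}(M_r,M)=\{J\in M_r : J\setminus\mu(M,J)=\{i\}\text{ for some } i\in\mathrm{Des}(M_r,M)\}$. -}

module Defs where

open import Data.Nat using (ℕ; _<_; _≤_)
open import Data.Fin using (Fin; toℕ)
open import Data.Fin.Subset using (Subset; _∈_; _∉_; _⊆_; _⊂_; Nonempty)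
open import Data.List using (List; length)
open import Data.List.Membership.Propositional renaming (_∈_ to _∈ᴸ_)
open import Data.List.Relation.Unary.Unique.Propositional using (Unique)
open import Data.Product using (Σ; ∃; _×_; _,_)
open import Data.Sum using (_⊎_)
open import Relation.Nullary using (¬_)
open import Relation.Binary.PropositionalEquality using (_≡_; _≢_)
open import Relation.Binary using (Rel; IsPartialOrder)
open import Relation.Binary.Construct.Closure.ReflexiveTransitive using (Star)
open import Level using (0ℓ)

record Poset (n : ℕ) : Set₁ where
  field
    _≤P_ : Rel (Fin n) 0ℓ
    isPartialOrder : IsPartialOrder _≡_ _≤P_

module _ {n : ℕ} (P : Poset n) where
  open Poset P

  _<P_ : Fin n → Fin n → Set
  i <P j = i ≤P j × i ≢ j

  NaturallyLabeled : Set
  NaturallyLabeled = ∀ i j → i <P j → toℕ i < toℕ j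

  Covers : Fin n → Fin n → Set
  Covers j i = i <P j × ¬ (∃ λ k → i <P k × k <P j)

  OrderIdeal : Subset n → Set
  OrderIdeal J = ∀ i j → i ∈ J → j ≤P i → j ∈ J

  HasseEdge : Subset n → Fin n → Fin n → Set
  HasseEdge J i j = i ∈ J × j ∈ J × (Covers i j ⊎ Covers j i)

  ConnectedIdeal : Subset n → Set
  ConnectedIdeal J = OrderIdeal J × Nonempty J ×
                     (∀ i j → i ∈ J → j ∈ J → Star (HasseEdge J) i j)

  Vertex : Subset n → Set
  Vertex = ConnectedIdeal

NontrivInter : {n : ℕ} → Subset n → Subset n → Set
NontrivInter A B = Nonempty' × ¬ (A ⊆ B) × ¬ (B ⊆ A)
  where Nonempty' = ∃ λ i → i ∈ A × i ∈ B

module _ {n : ℕ} (P : Poset n) where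

  Adj : Subset n → Subset n → Set
  Adj A B = Vertex P A × Vertex P B × NontrivInter A B

  InComponent : Subset n → Subset n → Set
  InComponent J₀ J = Star Adj J₀ J

  IndepIn : (Subset n → Set) → List (Subset n) → Set
  IndepIn V M = Unique M × (∀ J → J ∈ᴸ M → Vertex P J × V J) ×
                (∀ A B → A ∈ᴸ M → B ∈ᴸ M → ¬ Adj A B)

  MaxIndepIn : (Subset n → Set) → List (Subset n) → Set
  MaxIndepIn V M = IndepIn V M × (∀ M' → IndepIn V M' → length M' ≤ length M)

  AllVertices : Subset n → Set
  AllVertices _ = Data.Unit.⊤
    where import Data.Unit

  MaxIndep : List (Subset n) → Set
  MaxIndep = MaxIndepIn AllVertices

InMu : {n : ℕ} → List (Subset n) → Subset n → Fin n → Set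
InMu M J i = ∃ λ J' → J' ∈ᴸ M × J' ⊂ J × i ∈ J'

Label : {n : ℕ} → List (Subset n) → Subset n → Fin n → Set
Label M J i = i ∈ J × ¬ InMu M J i × (∀ k → k ∈ J → ¬ InMu M J k → k ≡ i)

_<F[_]_ : {n : ℕ} → Fin n → List (Subset n) → Fin n → Set
i <F[ M ] j = ∃ λ Ji → ∃ λ Jj → Ji ∈ᴸ M × Jj ∈ᴸ M × Label M Ji i × Label M Jj j × Ji ⊂ Jj

Parent : {n : ℕ} → List (Subset n) → Fin n → Fin n → Set
Parent M j i = i <F[ M ] j × ¬ (∃ λ k → i <F[ M ] k × k <F[ M ] j)

InDes : {n : ℕ} → List (Subset n) → Fin n → Set
InDes M i = ∃ λ j → Parent M j i × toℕ j < toℕ i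

InDesR : {n : ℕ} → List (Subset n) → List (Subset n) → Fin n → Set
InDesR Mr M i = InDes M i × ∃ λ J → J ∈ᴸ Mr × Label M J i

InDesBar : {n : ℕ} → List (Subset n) → List (Subset n) → Subset n → Set
InDesBar Mr M J = J ∈ᴸ Mr × ∃ λ i → InDesR Mr M i × Label M J i

module Submission where

-- Let i ∈ Des(M_r, M¹): i is the label of J ∈ M_r, and its parent j < i is the label of the
-- smallest member Jj ⊃ J of M¹. Natural labelling forces i to be maximal in Jj, so the Hasse
-- component Y of j in Jj − i is a connected ideal; it meets J without being comparable to it,
-- hence lies in the component C of J, and Jj = J ∪ Y. A member of M² either lies in C, and is
-- then a member of M¹, or is laminar with both J and Y; either way it does not cross Jj, so
-- maximality puts Jj into M². The same case analysis shows that J and Jj keep the labels i and j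
-- in M² with no member in between, so i ∈ Des(M_r, M²); symmetry gives equality.

import Data.Bool
open import Data.Empty using (⊥; ⊥-elim)
open import Data.Fin using (Fin; toℕ; zero; suc)
open import Data.Fin.Properties using (_≟_; any?; ∀-cons; <-cmp)
open import Data.Fin.Subset
  using (Subset; _∈_; _∉_; _⊆_; _⊂_; _⊃_; _─_; _-_; ⁅_⁆; ∣_∣; inside; outside)
open import Data.Fin.Subset.Properties
  using ( _∈?_; _⊆?_; _⊂?_; ⊆-antisym; ∣p∣≤n; p⊂q⇒∣p∣<∣q∣; p─q⊆p
        ; x∈p∧x≢y⇒x∈p-y; x∈⁅x⁆)
open import Data.List using (List; _∷_)
import Data.List.Membership.DecPropositional as DecMembership
open import Data.List.Membership.Propositional using (find) renaming (_∈_ to _∈ᴸ_; _∉_ to _∉ᴸ_)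
open import Data.List.Membership.Propositional.Properties.Core using (∃∈-Any)
import Data.List.Relation.Unary.All as ListAll
open import Data.List.Relation.Unary.AllPairs using (_∷_)
import Data.List.Relation.Unary.Any as Any
open import Data.List.Relation.Unary.Any using (here; there)
open import Data.List.Relation.Unary.Unique.Propositional using (Unique)
open import Data.Nat using (ℕ; _<_; _≤_; _∸_)
open import Data.Nat.Induction using (<-wellFounded)
open import Data.Nat.Properties
  using (≤-refl; <⇒≤; <-irrefl; <-asym; <-≤-trans; 1+n≰n; ∸-monoˡ-<; ∸-monoʳ-<)
open import Data.Product using (∃; ∃₂; _×_; _,_; proj₁; proj₂)
open import Data.Sum using (_⊎_; inj₁; inj₂)
open import Data.Unit using (tt)
open import Data.Vec using ([]; _∷_; here; there; tabulate)
open import Data.Vec.Properties using (≡-dec; lookup⇒[]=; []=⇒lookup; lookup∘tabulate)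
open import Function using (_∘_)
open import Function.Bundles using (_⇔_; Equivalence; mk⇔)
open import Induction.WellFounded using (WellFounded; Acc; acc; module Subrelation; module All)
open import Relation.Binary using (Decidable; Sym; IsPartialOrder)
import Relation.Binary.Construct.On as On
open import Relation.Binary.Construct.Closure.ReflexiveTransitive using (Star; ε; _◅_; _◅◅_; reverse)
import Relation.Binary.Construct.Closure.ReflexiveTransitive as Star
open import Relation.Binary.Definitions using (tri<; tri≈; tri>)
open import Relation.Binary.PropositionalEquality using (_≡_; _≢_; refl; sym; trans; subst; subst₂)
open import Relation.Nullary using (¬_; Dec; yes; no; does)
open import Relation.Nullary.Decidable
  using (¬¬-excluded-middle; dec-true; decidable-stable; map′; _×-dec_; _⊎-dec_; ¬?)

open import Defs

comprehension : ∀ {n} {Q : Fin n → Set} → (∀ x → Dec (Q x)) → Subset n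
comprehension Q? = tabulate (does ∘ Q?)

module _ {n} {Q : Fin n → Set} (Q? : ∀ x → Dec (Q x)) where

  ∈-comprehension⁺ : ∀ {x} → Q x → x ∈ comprehension Q?
  ∈-comprehension⁺ {x} q = lookup⇒[]= x _ (trans (lookup∘tabulate _ x) (dec-true (Q? x) q))

  ∈-comprehension⁻ : ∀ {x} → x ∈ comprehension Q? → Q x
  ∈-comprehension⁻ {x} x∈ with Q? x | trans (sym (lookup∘tabulate (does ∘ Q?) x)) ([]=⇒lookup x∈)
  ... | yes q | _ = q
  ... | no _ | ()

¬¬-∀-Fin : ∀ {n} {Q : Fin n → Set} → (∀ x → ¬ ¬ Q x) → ¬ ¬ (∀ x → Q x)
¬¬-∀-Fin {ℕ.zero} _ k = k (λ ())
¬¬-∀-Fin {ℕ.suc n} h k = h zero λ q₀ → ¬¬-∀-Fin (h ∘ suc) λ qₛ → k (∀-cons q₀ qₛ)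

¬¬-∀-Subset : ∀ {n} {Q : Subset n → Set} → (∀ p → ¬ ¬ Q p) → ¬ ¬ (∀ p → Q p)
¬¬-∀-Subset {ℕ.zero} h k = h [] λ q → k λ { [] → q }
¬¬-∀-Subset {ℕ.suc n} h k =
  ¬¬-∀-Subset (h ∘ (inside ∷_)) λ qᵢ → ¬¬-∀-Subset (h ∘ (outside ∷_)) λ qₒ →
  k λ { (inside ∷ p) → qᵢ p ; (outside ∷ p) → qₒ p }

x∈p─q⇒x∉q : ∀ {n} {p q : Subset n} {x} → x ∈ p ─ q → x ∉ q
x∈p─q⇒x∉q {p = _ ∷ _} {outside ∷ _} here ()
x∈p─q⇒x∉q {p = _ ∷ _} {_ ∷ _} (there x∈) (there x∈q) = x∈p─q⇒x∉q x∈ x∈q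

x∈p-y⇒x≢y : ∀ {n} {p : Subset n} {x y} → x ∈ p - y → x ≢ y
x∈p-y⇒x≢y {y = y} x∈ refl = x∈p─q⇒x∉q x∈ (x∈⁅x⁆ y)

p⊆q⇒p-x⊆q-x : ∀ {n} {p q : Subset n} {x} → p ⊆ q → p - x ⊆ q - x
p⊆q⇒p-x⊆q-x {p = p} {x = x} p⊆q y∈ = x∈p∧x≢y⇒x∈p-y (p⊆q (p─q⊆p p ⁅ x ⁆ y∈)) (x∈p-y⇒x≢y y∈)

⊆⇒⊂⊎≡ : ∀ {n} {A B : Subset n} → A ⊆ B → A ⊂ B ⊎ A ≡ B
⊆⇒⊂⊎≡ {A = A} {B} A⊆B with any? (λ x → x ∈? B ×-dec ¬? (x ∈? A))
... | yes (x , x∈B , x∉A) = inj₁ (A⊆B , x , x∈B , x∉A)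
... | no ∄x = inj₂ (⊆-antisym A⊆B λ {x} x∈B →
  decidable-stable (x ∈? A) λ x∉A → ∄x (x , x∈B , x∉A))

⊃-wellFounded : ∀ {n} → WellFounded (_⊃_ {n})
⊃-wellFounded {n} = Subrelation.wellFounded ⊃⇒∸<
  (On.wellFounded (λ K → n ∸ ∣ K ∣) <-wellFounded)
  where
  ⊃⇒∸< : ∀ {A B : Subset n} → A ⊃ B → n ∸ ∣ A ∣ < n ∸ ∣ B ∣
  ⊃⇒∸< {A} B⊂A = ∸-monoʳ-< (p⊂q⇒∣p∣<∣q∣ B⊂A) (∣p∣≤n A)

module HassePaths {n : ℕ} (P : Poset n) where
  open Poset P
  open IsPartialOrder isPartialOrder using () renaming (refl to ≤P-refl; trans to ≤P-trans)

  HassePath : Subset n → Fin n → Fin n → Set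
  HassePath S = Star (HasseEdge P S)

  HasseEdge-sym : ∀ {S} → Sym (HasseEdge P S) (HasseEdge P S)
  HasseEdge-sym (x∈ , y∈ , inj₁ y⋖x) = y∈ , x∈ , inj₂ y⋖x
  HasseEdge-sym (x∈ , y∈ , inj₂ x⋖y) = y∈ , x∈ , inj₁ x⋖y

  HassePath-sym : ∀ {S} → Sym (HassePath S) (HassePath S)
  HassePath-sym = reverse HasseEdge-sym

  HassePath-mono : ∀ {S T} → S ⊆ T → ∀ {x y} → HassePath S x y → HassePath T x y
  HassePath-mono S⊆T = Star.map λ (x∈ , y∈ , cov) → S⊆T x∈ , S⊆T y∈ , cov

  HassePath-end∈ : ∀ {S x y} → x ∈ S → HassePath S x y → y ∈ S
  HassePath-end∈ x∈ ε = x∈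
  HassePath-end∈ _ ((_ , z∈ , _) ◅ p) = HassePath-end∈ z∈ p

  HassePath-exit : ∀ {K T x y} → x ∈ K → y ∉ K → HassePath T x y →
                   ∃₂ λ u v → u ∈ K × v ∉ K × HasseEdge P T u v
  HassePath-exit x∈ y∉ ε = ⊥-elim (y∉ x∈)
  HassePath-exit {K} {x = x} x∈ y∉ (_◅_ {j = z} e p) with z ∈? K
  ... | yes z∈ = HassePath-exit z∈ y∉ p
  ... | no z∉ = x , z , x∈ , z∉ , e

  HassePath-last-edge : ∀ {J a i} → HassePath J a i → a ≢ i →
                        ∃ λ b → HasseEdge P J b i × HassePath (J - i) a b
  HassePath-last-edge ε a≢i = ⊥-elim (a≢i refl)
  HassePath-last-edge {a = a} {i} (_◅_ {j = z} e p) a≢i with z ≟ i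
  ... | yes refl = a , e , ε
  ... | no z≢i with HassePath-last-edge p z≢i
  ...   | b , b⋖i , q =
    let (a∈J , z∈J , a—z) = e in
    b , b⋖i , (x∈p∧x≢y⇒x∈p-y a∈J a≢i , x∈p∧x≢y⇒x∈p-y z∈J z≢i , a—z) ◅ q

  module _ (nat : NaturallyLabeled P) (_≤?_ : Decidable _≤P_) where

    _<P?_ : Decidable (_<P_ P)
    x <P? y = (x ≤? y) ×-dec ¬? (x ≟ y)

    ≤P⇒≤ : ∀ {x y} → x ≤P y → toℕ x ≤ toℕ y
    ≤P⇒≤ {x} {y} x≤y with x ≟ y
    ... | yes refl = ≤-refl
    ... | no x≢y = <⇒≤ (nat x y (x≤y , x≢y))

    -- Natural labelling makes toℕ x ∸ toℕ z decrease when z < k < x is split at k.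
    ≤P⇒HassePath : ∀ {S z x} → (∀ {w} → w ≤P x → w ∈ S) → z ≤P x → HassePath S z x
    ≤P⇒HassePath down z≤x = go down z≤x (<-wellFounded _)
      where
      go : ∀ {S z x} → (∀ {w} → w ≤P x → w ∈ S) → z ≤P x →
           Acc _<_ (toℕ x ∸ toℕ z) → HassePath S z x
      go {z = z} {x} down z≤x (acc rec) with z ≟ x
      ... | yes refl = ε
      ... | no z≢x with any? (λ k → (z <P? k) ×-dec (k <P? x))
      ...   | no ∄k = (down z≤x , down ≤P-refl , inj₂ ((z≤x , z≢x) , ∄k)) ◅ ε
      ...   | yes (k , z<k , k<x) =
        go (λ w≤k → down (≤P-trans w≤k (proj₁ k<x))) (proj₁ z<k)
           (rec (∸-monoˡ-< (nat k x k<x) (<⇒≤ (nat z k z<k))))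
        ◅◅ go down (proj₁ k<x) (rec (∸-monoʳ-< (nat z k z<k) (<⇒≤ (nat k x k<x))))

Disjoint : ∀ {n} → Subset n → Subset n → Set
Disjoint A B = ∀ {z} → z ∈ A → z ∉ B

InMu? : ∀ {n} M (J : Subset n) i → Dec (InMu M J i)
InMu? M J i = map′ find ∃∈-Any (Any.any? (λ J' → J' ⊂? J ×-dec i ∈? J') M)

Label-stable : ∀ {n M} {J : Subset n} {i} → i ∈ J → ¬ ¬ Label M J i → Label M J i
Label-stable {i = i} i∈J ¬¬L =
  i∈J , (λ i∈μ → ¬¬L λ L → proj₁ (proj₂ L) i∈μ) ,
  λ k k∈J k∉μ → decidable-stable (k ≟ i) λ k≢i → ¬¬L λ L → k≢i (proj₂ (proj₂ L) k k∈J k∉μ)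

NontrivInter-sym : ∀ {n} {A B : Subset n} → NontrivInter A B → NontrivInter B A
NontrivInter-sym ((z , z∈A , z∈B) , A⊈B , B⊈A) = (z , z∈B , z∈A) , B⊈A , A⊈B

module IndependentSets {n : ℕ} (P : Poset n) where
  open Poset P
  open IsPartialOrder isPartialOrder using () renaming (refl to ≤P-refl; trans to ≤P-trans)
  open HassePaths P

  ¬Adj⇒laminar : ∀ {A B} → Vertex P A → Vertex P B → ¬ Adj P A B →
                 A ⊆ B ⊎ B ⊆ A ⊎ Disjoint A B
  ¬Adj⇒laminar {A} {B} vA vB ¬adj with A ⊆? B | B ⊆? A
  ... | yes A⊆B | _ = inj₁ A⊆B
  ... | no _ | yes B⊆A = inj₂ (inj₁ B⊆A)
  ... | no A⊈B | no B⊈A = inj₂ (inj₂ λ z∈A z∈B → ¬adj (vA , vB , (_ , z∈A , z∈B) , A⊈B , B⊈A))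

  disjoint-ideals⇒¬HasseEdge : ∀ {A B T u v} → OrderIdeal P A → OrderIdeal P B → Disjoint A B →
                              u ∈ A → v ∈ B → ¬ HasseEdge P T u v
  disjoint-ideals⇒¬HasseEdge idA _ A∩B≡∅ u∈A v∈B (_ , _ , inj₁ ((v≤u , _) , _)) =
    A∩B≡∅ (idA _ _ u∈A v≤u) v∈B
  disjoint-ideals⇒¬HasseEdge _ idB A∩B≡∅ u∈A v∈B (_ , _ , inj₂ ((u≤v , _) , _)) =
    A∩B≡∅ u∈A (idB _ _ v∈B u≤v)

  module Independent {V : Subset n → Set} {M : List (Subset n)} (ind : IndepIn P V M) where

    vertex : ∀ {A} → A ∈ᴸ M → Vertex P A
    vertex A∈M = proj₁ (proj₁ (proj₂ ind) _ A∈M)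

    member-ideal : ∀ {A x y} → A ∈ᴸ M → x ∈ A → y ≤P x → y ∈ A
    member-ideal A∈M x∈A y≤x = proj₁ (vertex A∈M) _ _ x∈A y≤x

    member-nonempty : ∀ {A} → A ∈ᴸ M → ∃ λ x → x ∈ A
    member-nonempty A∈M = proj₁ (proj₂ (vertex A∈M))

    member-path : ∀ {A x y} → A ∈ᴸ M → x ∈ A → y ∈ A → HassePath A x y
    member-path A∈M x∈A y∈A = proj₂ (proj₂ (vertex A∈M)) _ _ x∈A y∈A

    independent : ∀ {A B} → A ∈ᴸ M → B ∈ᴸ M → ¬ Adj P A B
    independent = proj₂ (proj₂ ind) _ _

    laminar : ∀ {A B} → A ∈ᴸ M → B ∈ᴸ M → A ⊆ B ⊎ B ⊆ A ⊎ Disjoint A B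
    laminar A∈M B∈M = ¬Adj⇒laminar (vertex A∈M) (vertex B∈M) (independent A∈M B∈M)

    Label-injective : ∀ {A B i} → A ∈ᴸ M → B ∈ᴸ M → Label M A i → Label M B i → A ≡ B
    Label-injective A∈M B∈M LA LB with laminar A∈M B∈M
    ... | inj₂ (inj₂ A∩B≡∅) = ⊥-elim (A∩B≡∅ (proj₁ LA) (proj₁ LB))
    ... | inj₁ A⊆B with ⊆⇒⊂⊎≡ A⊆B
    ...   | inj₁ A⊂B = ⊥-elim (proj₁ (proj₂ LB) (_ , A∈M , A⊂B , proj₁ LA))
    ...   | inj₂ A≡B = A≡B
    Label-injective A∈M B∈M LA LB | inj₂ (inj₁ B⊆A) with ⊆⇒⊂⊎≡ B⊆A
    ...   | inj₁ B⊂A = ⊥-elim (proj₁ (proj₂ LA) (_ , B∈M , B⊂A , proj₁ LB))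
    ...   | inj₂ B≡A = sym B≡A

    μ-exhausts⇒no-member-below : ∀ {W} → W ∈ᴸ M → (∀ {x} → x ∈ W → InMu M W x) →
                                 ∀ {K} → K ∈ᴸ M → ¬ K ⊂ W
    μ-exhausts⇒no-member-below {W} W∈M all-in-μ {K} = All.wfRec ⊃-wellFounded _ NotBelow step K
      where
      NotBelow : Subset n → Set
      NotBelow K = K ∈ᴸ M → ¬ K ⊂ W
      step : ∀ K → (∀ {K'} → K' ⊃ K → NotBelow K') → NotBelow K
      step K rec K∈M (K⊆W , b , b∈W , b∉K)
        with (a , a∈K) ← member-nonempty K∈M
        with (u , v , u∈K , v∉K , u—v) ← HassePath-exit a∈K b∉K (member-path W∈M (K⊆W a∈K) b∈W)
        with (K' , K'∈M , K'⊂W , v∈K') ← all-in-μ (proj₁ (proj₂ u—v))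
        with laminar K∈M K'∈M
      ... | inj₁ K⊆K' = rec (K⊆K' , v , v∈K' , v∉K) K'∈M K'⊂W
      ... | inj₂ (inj₁ K'⊆K) = v∉K (K'⊆K v∈K')
      ... | inj₂ (inj₂ K∩K'≡∅) =
        disjoint-ideals⇒¬HasseEdge (proj₁ (vertex K∈M)) (proj₁ (vertex K'∈M)) K∩K'≡∅ u∈K v∈K' u—v

    μ-proper : ∀ {W} → W ∈ᴸ M → ∃ λ x → x ∈ W × ¬ InMu M W x
    μ-proper {W} W∈M = decidable-stable (any? λ x → x ∈? W ×-dec ¬? (InMu? M W x)) λ ∄x →
      let all-in-μ : ∀ {x} → x ∈ W → InMu M W x
          all-in-μ {x} x∈W = decidable-stable (InMu? M W x) λ x∉μ → ∄x (x , x∈W , x∉μ)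
          (a , a∈W) = member-nonempty W∈M
          (K , K∈M , K⊂W , _) = all-in-μ a∈W
      in μ-exhausts⇒no-member-below W∈M all-in-μ K∈M K⊂W

  module Maximum {M : List (Subset n)} (max : MaxIndep P M) where
    open Independent (proj₁ max) public
    open DecMembership {A = Subset n} (≡-dec Data.Bool._≟_) using () renaming (_∈?_ to _∈ᴸ?_)

    maximum-absorbs : ∀ {N} → Vertex P N → (∀ {X} → X ∈ᴸ M → ¬ NontrivInter X N) → N ∈ᴸ M
    maximum-absorbs {N} vN uncrossed = decidable-stable (N ∈ᴸ? M) λ N∉M →
      1+n≰n (proj₂ max (N ∷ M) (unique N∉M , vertices , nonadjacent))
      where
      unique : N ∉ᴸ M → Unique (N ∷ M)
      unique N∉M =
        ListAll.tabulate (λ X∈M N≡X → N∉M (subst (_∈ᴸ M) (sym N≡X) X∈M)) ∷ proj₁ (proj₁ max)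
      vertices : ∀ J → J ∈ᴸ N ∷ M → Vertex P J × AllVertices P J
      vertices _ (here refl) = vN , tt
      vertices J (there J∈M) = proj₁ (proj₂ (proj₁ max)) J J∈M
      nonadjacent : ∀ A B → A ∈ᴸ N ∷ M → B ∈ᴸ N ∷ M → ¬ Adj P A B
      nonadjacent _ _ (here refl) (here refl) (_ , _ , _ , N⊈N , _) = N⊈N λ z∈N → z∈N
      nonadjacent _ _ (here refl) (there B∈M) (_ , _ , crossing) =
        uncrossed B∈M (NontrivInter-sym crossing)
      nonadjacent _ _ (there A∈M) (here refl) (_ , _ , crossing) = uncrossed A∈M crossing
      nonadjacent _ _ (there A∈M) (there B∈M) = independent A∈M B∈M

    module _ (nat : NaturallyLabeled P) (_≤?_ : Decidable _≤P_) where

      module DownSaturation {W x} (W∈M : W ∈ᴸ M) (x∈W : x ∈ W) where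

        MeetsBelow : Subset n → Set
        MeetsBelow K = ∃ λ w → w ∈ K × w ≤P x

        MeetsBelow? : ∀ K → Dec (MeetsBelow K)
        MeetsBelow? K = any? λ w → w ∈? K ×-dec w ≤? x

        InN : Fin n → Set
        InN z = z ≤P x ⊎ ∃ λ K → K ∈ᴸ M × (K ⊂ W × MeetsBelow K) × z ∈ K

        InN? : ∀ z → Dec (InN z)
        InN? z = (z ≤? x) ⊎-dec
          map′ find ∃∈-Any (Any.any? (λ K → (K ⊂? W ×-dec MeetsBelow? K) ×-dec z ∈? K) M)

        N : Subset n
        N = comprehension InN?

        N⊆W : N ⊆ W
        N⊆W z∈N with ∈-comprehension⁻ InN? z∈N
        ... | inj₁ z≤x = member-ideal W∈M x∈W z≤x
        ... | inj₂ (_ , _ , ((K⊆W , _) , _) , z∈K) = K⊆W z∈K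

        x∈N : x ∈ N
        x∈N = ∈-comprehension⁺ InN? (inj₁ ≤P-refl)

        HassePath-to-x : ∀ {z} → z ∈ N → HassePath N z x
        HassePath-to-x z∈N with ∈-comprehension⁻ InN? z∈N
        ... | inj₁ z≤x = ≤P⇒HassePath nat _≤?_ (∈-comprehension⁺ InN? ∘ inj₁) z≤x
        ... | inj₂ (K , K∈M , below@(_ , w , w∈K , w≤x) , z∈K) =
          HassePath-mono (λ u∈K → ∈-comprehension⁺ InN? (inj₂ (K , K∈M , below , u∈K)))
            (member-path K∈M z∈K w∈K)
          ◅◅ ≤P⇒HassePath nat _≤?_ (∈-comprehension⁺ InN? ∘ inj₁) w≤x

        N-vertex : Vertex P N
        N-vertex = ideal , (x , x∈N) , λ a b a∈N b∈N →
          HassePath-to-x a∈N ◅◅ HassePath-sym (HassePath-to-x b∈N)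
          where
          ideal : OrderIdeal P N
          ideal z z' z∈N z'≤z with ∈-comprehension⁻ InN? z∈N
          ... | inj₁ z≤x = ∈-comprehension⁺ InN? (inj₁ (≤P-trans z'≤z z≤x))
          ... | inj₂ (K , K∈M , below , z∈K) =
            ∈-comprehension⁺ InN? (inj₂ (K , K∈M , below , member-ideal K∈M z∈K z'≤z))

        N-uncrossed : ∀ {A} → A ∈ᴸ M → ¬ NontrivInter A N
        N-uncrossed {A} A∈M ((z , z∈A , z∈N) , A⊈N , N⊈A) with laminar A∈M W∈M
        ... | inj₂ (inj₁ W⊆A) = N⊈A λ u∈N → W⊆A (N⊆W u∈N)
        ... | inj₂ (inj₂ A∩W≡∅) = A∩W≡∅ z∈A (N⊆W z∈N)
        ... | inj₁ A⊆W with ⊆⇒⊂⊎≡ A⊆W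
        ...   | inj₂ refl = N⊈A N⊆W
        ...   | inj₁ A⊂W with MeetsBelow? A
        ...     | yes meets = A⊈N λ u∈A → ∈-comprehension⁺ InN? (inj₂ (A , A∈M , (A⊂W , meets) , u∈A))
        ...     | no ¬meets with ∈-comprehension⁻ InN? z∈N
        ...       | inj₁ z≤x = ¬meets (z , z∈A , z≤x)
        ...       | inj₂ (K , K∈M , below@(_ , w , w∈K , w≤x) , z∈K) with laminar A∈M K∈M
        ...         | inj₁ A⊆K = A⊈N λ u∈A → ∈-comprehension⁺ InN? (inj₂ (K , K∈M , below , A⊆K u∈A))
        ...         | inj₂ (inj₁ K⊆A) = ¬meets (w , K⊆A w∈K , w≤x)
        ...         | inj₂ (inj₂ A∩K≡∅) = A∩K≡∅ z∈A z∈K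

      -- N (the down-set of x with every member below W that meets it) is absorbed into M,
      -- and misses y since natural labelling gives y ≰ x; so N witnesses x ∈ μ(M,W).
      outside-μ-increasing⇒⊥ : ∀ {W x y} → W ∈ᴸ M → x ∈ W → ¬ InMu M W x → y ∈ W → ¬ InMu M W y →
                               toℕ x < toℕ y → ⊥
      outside-μ-increasing⇒⊥ W∈M x∈W x∉μ y∈W y∉μ x<y =
        x∉μ (N , maximum-absorbs N-vertex N-uncrossed , (N⊆W , _ , y∈W , y∉N) , x∈N)
        where
        open DownSaturation W∈M x∈W
        y∉N : _ ∉ N
        y∉N y∈N with ∈-comprehension⁻ InN? y∈N
        ... | inj₁ y≤x = <-irrefl refl (<-≤-trans x<y (≤P⇒≤ nat _≤?_ y≤x))
        ... | inj₂ (K , K∈M , (K⊂W , _) , y∈K) = y∉μ (K , K∈M , K⊂W , y∈K)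

      outside-μ-unique : ∀ {W x y} → W ∈ᴸ M → x ∈ W → ¬ InMu M W x → y ∈ W → ¬ InMu M W y → x ≡ y
      outside-μ-unique {x = x} {y} W∈M x∈W x∉μ y∈W y∉μ with <-cmp x y
      ... | tri< x<y _ _ = ⊥-elim (outside-μ-increasing⇒⊥ W∈M x∈W x∉μ y∈W y∉μ x<y)
      ... | tri≈ _ x≡y _ = x≡y
      ... | tri> _ _ y<x = ⊥-elim (outside-μ-increasing⇒⊥ W∈M y∈W y∉μ x∈W x∉μ y<x)

      Label-intro : ∀ {W x} → W ∈ᴸ M → x ∈ W → ¬ InMu M W x → Label M W x
      Label-intro W∈M x∈W x∉μ = x∈W , x∉μ , λ k k∈W k∉μ → outside-μ-unique W∈M k∈W k∉μ x∈W x∉μ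

      Label-exists : ∀ {W} → W ∈ᴸ M → ∃ (Label M W)
      Label-exists W∈M = let (x , x∈W , x∉μ) = μ-proper W∈M in x , Label-intro W∈M x∈W x∉μ

module ParentPreserved
  {n : ℕ} (P : Poset n) (nat : NaturallyLabeled P) (_≤?_ : Decidable (Poset._≤P_ P))
  (C : Subset n → Set) (C? : ∀ X → Dec (C X)) (C-closed : ∀ {A B} → C A → Adj P A B → C B)
  (HassePath? : ∀ S a x → Dec (HassePaths.HassePath P S a x))
  {M¹ M² : List (Subset n)} (max¹ : MaxIndep P M¹) (max² : MaxIndep P M²)
  (C∩M²⊆M¹ : ∀ {X} → C X → X ∈ᴸ M² → X ∈ᴸ M¹)
  {J Jj : Subset n} {i j : Fin n}
  (J∈M¹ : J ∈ᴸ M¹) (J∈M² : J ∈ᴸ M²) (J∈C : C J) (LJ : Label M¹ J i)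
  (Jj∈M¹ : Jj ∈ᴸ M¹) (LJj : Label M¹ Jj j) (J⊂Jj : J ⊂ Jj) (j<i : toℕ j < toℕ i)
  (parent : ¬ ∃ λ k → i <F[ M¹ ] k × k <F[ M¹ ] j) where

  open Poset P
  open HassePaths P
  open IndependentSets P
  module M¹ = Maximum max¹
  module M² = Maximum max²

  i∈J : i ∈ J
  i∈J = proj₁ LJ

  j∈Jj : j ∈ Jj
  j∈Jj = proj₁ LJj

  J⊆Jj : J ⊆ Jj
  J⊆Jj = proj₁ J⊂Jj

  J-vertex : Vertex P J
  J-vertex = M¹.vertex J∈M¹

  Jj-vertex : Vertex P Jj
  Jj-vertex = M¹.vertex Jj∈M¹

  j∉member¹-below : ∀ {K} → K ∈ᴸ M¹ → K ⊂ Jj → j ∉ K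
  j∉member¹-below K∈M¹ K⊂Jj j∈K = proj₁ (proj₂ LJj) (_ , K∈M¹ , K⊂Jj , j∈K)

  j∉J : j ∉ J
  j∉J = j∉member¹-below J∈M¹ J⊂Jj

  j≢i : j ≢ i
  j≢i refl = <-irrefl refl j<i

  i≮j : ¬ _<P_ P i j
  i≮j i<j = <-asym j<i (nat i j i<j)

  no-member¹-between : ∀ {K} → K ∈ᴸ M¹ → J ⊂ K → K ⊂ Jj → ⊥
  no-member¹-between K∈M¹ J⊂K K⊂Jj =
    let (k , LK) = M¹.Label-exists nat _≤?_ K∈M¹ in
    parent (k , (J , _ , J∈M¹ , K∈M¹ , LJ , LK , J⊂K) , (_ , Jj , K∈M¹ , Jj∈M¹ , LK , LJj , K⊂Jj))

  member¹-disjoint-from-J : ∀ {z} → z ∈ Jj → z ∉ J → z ≢ j →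
                            ∃ λ K → K ∈ᴸ M¹ × K ⊂ Jj × z ∈ K × Disjoint K J
  member¹-disjoint-from-J z∈Jj z∉J z≢j
    with (K , K∈M¹ , K⊂Jj , z∈K) ←
           decidable-stable (InMu? M¹ Jj _) (λ z∉μ → z≢j (proj₂ (proj₂ LJj) _ z∈Jj z∉μ))
    with M¹.laminar K∈M¹ J∈M¹
  ... | inj₁ K⊆J = ⊥-elim (z∉J (K⊆J z∈K))
  ... | inj₂ (inj₂ K∩J≡∅) = K , K∈M¹ , K⊂Jj , z∈K , K∩J≡∅
  ... | inj₂ (inj₁ J⊆K) with ⊆⇒⊂⊎≡ J⊆K
  ...   | inj₁ J⊂K = ⊥-elim (no-member¹-between K∈M¹ J⊂K K⊂Jj)
  ...   | inj₂ refl = ⊥-elim (z∉J z∈K)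

  i-maximal : ∀ {k} → k ∈ Jj → i ≤P k → k ≡ i
  i-maximal {k} k∈Jj i≤k = decidable-stable (k ≟ i) absurd
    where
    absurd : ¬ k ≢ i
    absurd k≢i with k ∈? J | k ≟ j
    ... | yes k∈J | _ = k≢i (proj₂ (proj₂ LJ) k k∈J λ (K , K∈M¹ , K⊂J , k∈K) →
                          proj₁ (proj₂ LJ) (K , K∈M¹ , K⊂J , M¹.member-ideal K∈M¹ k∈K i≤k))
    ... | no _ | yes refl = i≮j (i≤k , λ i≡k → k≢i (sym i≡k))
    ... | no k∉J | no k≢j with (K , K∈M¹ , _ , k∈K , K∩J≡∅) ← member¹-disjoint-from-J k∈Jj k∉J k≢j =
      K∩J≡∅ (M¹.member-ideal K∈M¹ k∈K i≤k) i∈J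

  -- A Hasse path from i to j inside Jj must leave J upwards, and only into j.
  lower-neighbour : ∃ λ a → a ∈ J × a ≢ i × a ≤P j
  lower-neighbour
    with (u , v , u∈J , v∉J , (_ , v∈Jj , u—v)) ←
           HassePath-exit i∈J j∉J (M¹.member-path Jj∈M¹ (J⊆Jj i∈J) j∈Jj)
    with u—v
  ... | inj₁ ((v≤u , _) , _) = ⊥-elim (v∉J (M¹.member-ideal J∈M¹ u∈J v≤u))
  ... | inj₂ ((u≤v , u≢v) , _) with v ≟ j
  ...   | yes refl = u , u∈J , (λ { refl → i≮j (u≤v , u≢v) }) , u≤v
  ...   | no v≢j with (K , K∈M¹ , _ , v∈K , K∩J≡∅) ← member¹-disjoint-from-J v∈Jj v∉J v≢j =
    ⊥-elim (K∩J≡∅ (M¹.member-ideal K∈M¹ v∈K u≤v) u∈J)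

  a : Fin n
  a = proj₁ lower-neighbour

  a∈J : a ∈ J
  a∈J = proj₁ (proj₂ lower-neighbour)

  a≢i : a ≢ i
  a≢i = proj₁ (proj₂ (proj₂ lower-neighbour))

  a≤j : a ≤P j
  a≤j = proj₂ (proj₂ (proj₂ lower-neighbour))

  S : Subset n
  S = Jj - i

  Y : Subset n
  Y = comprehension (HassePath? S j)

  ∈Y⁺ : ∀ {x} → HassePath S j x → x ∈ Y
  ∈Y⁺ = ∈-comprehension⁺ (HassePath? S j)

  ∈Y⁻ : ∀ {x} → x ∈ Y → HassePath S j x
  ∈Y⁻ = ∈-comprehension⁻ (HassePath? S j)

  j∈S : j ∈ S
  j∈S = x∈p∧x≢y⇒x∈p-y j∈Jj j≢i

  Y⊆Jj : Y ⊆ Jj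
  Y⊆Jj y∈Y = p─q⊆p Jj ⁅ i ⁆ (HassePath-end∈ j∈S (∈Y⁻ y∈Y))

  i∉Y : i ∉ Y
  i∉Y i∈Y = x∈p-y⇒x≢y (HassePath-end∈ j∈S (∈Y⁻ i∈Y)) refl

  j∈Y : j ∈ Y
  j∈Y = ∈Y⁺ ε

  below-in-S : ∀ {x w} → x ∈ Jj → x ≢ i → w ≤P x → w ∈ S
  below-in-S x∈Jj x≢i w≤x =
    x∈p∧x≢y⇒x∈p-y (M¹.member-ideal Jj∈M¹ x∈Jj w≤x) λ { refl → x≢i (i-maximal x∈Jj w≤x) }

  HassePath-within-Y : ∀ {x y} → HassePath S j x → HassePath S x y → HassePath Y x y
  HassePath-within-Y j→x ε = ε
  HassePath-within-Y j→x (e ◅ p) =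
    (∈Y⁺ j→x , ∈Y⁺ j→y , proj₂ (proj₂ e)) ◅ HassePath-within-Y j→y p
    where j→y = j→x ◅◅ (e ◅ ε)

  Y-vertex : Vertex P Y
  Y-vertex = ideal , (j , j∈Y) , λ x y x∈Y y∈Y →
    HassePath-sym (HassePath-within-Y ε (∈Y⁻ x∈Y)) ◅◅ HassePath-within-Y ε (∈Y⁻ y∈Y)
    where
    ideal : OrderIdeal P Y
    ideal x z x∈Y z≤x = ∈Y⁺ (∈Y⁻ x∈Y ◅◅ HassePath-sym
      (≤P⇒HassePath nat _≤?_ (below-in-S (Y⊆Jj x∈Y) λ { refl → i∉Y x∈Y }) z≤x))

  a∈Y : a ∈ Y
  a∈Y = ∈Y⁺ (HassePath-sym (≤P⇒HassePath nat _≤?_ (below-in-S j∈Jj j≢i) a≤j))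

  Y∈C : C Y
  Y∈C = C-closed J∈C
    (J-vertex , Y-vertex , (a , a∈J , a∈Y) , (λ J⊆Y → i∉Y (J⊆Y i∈J)) , λ Y⊆J → j∉J (Y⊆J j∈Y))

  disjoint-from-J⇒⊆S : ∀ {K} → K ⊆ Jj → Disjoint K J → K ⊆ S
  disjoint-from-J⇒⊆S K⊆Jj K∩J≡∅ z∈K = x∈p∧x≢y⇒x∈p-y (K⊆Jj z∈K) λ { refl → K∩J≡∅ z∈K i∈J }

  member¹-⊆Y : ∀ {K} → K ∈ᴸ M¹ → K ⊂ Jj → Disjoint K J → K ⊆ Y
  member¹-⊆Y {K} = All.wfRec ⊃-wellFounded _ InsideY step K
    where
    InsideY : Subset n → Set
    InsideY K = K ∈ᴸ M¹ → K ⊂ Jj → Disjoint K J → K ⊆ Y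
    step : ∀ K → (∀ {K'} → K' ⊃ K → InsideY K') → InsideY K
    step K rec K∈M¹ K⊂Jj@(K⊆Jj , _) K∩J≡∅
      with (b , b∈K) ← M¹.member-nonempty K∈M¹
      with (u , v , u∈K , v∉K , (_ , v∈Jj , u—v)) ←
             HassePath-exit b∈K (j∉member¹-below K∈M¹ K⊂Jj) (M¹.member-path Jj∈M¹ (K⊆Jj b∈K) j∈Jj)
      with u—v
    ... | inj₁ ((v≤u , _) , _) = ⊥-elim (v∉K (M¹.member-ideal K∈M¹ u∈K v≤u))
    ... | inj₂ u⋖v with v ≟ j
    ...   | yes refl = λ z∈K → let K⊆S = disjoint-from-J⇒⊆S K⊆Jj K∩J≡∅ in
      ∈Y⁺ ((j∈S , K⊆S u∈K , inj₁ u⋖v) ◅ HassePath-mono K⊆S (M¹.member-path K∈M¹ u∈K z∈K))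
    ...   | no v≢j with v ∈? J
    ...     | yes v∈J = ⊥-elim (K∩J≡∅ u∈K (M¹.member-ideal J∈M¹ v∈J (proj₁ (proj₁ u⋖v))))
    ...     | no v∉J with (K' , K'∈M¹ , K'⊂Jj , v∈K' , K'∩J≡∅) ← member¹-disjoint-from-J v∈Jj v∉J v≢j
                     with M¹.laminar K∈M¹ K'∈M¹
    ...       | inj₁ K⊆K' = λ z∈K → rec (K⊆K' , v , v∈K' , v∉K) K'∈M¹ K'⊂Jj K'∩J≡∅ (K⊆K' z∈K)
    ...       | inj₂ (inj₁ K'⊆K) = ⊥-elim (v∉K (K'⊆K v∈K'))
    ...       | inj₂ (inj₂ K∩K'≡∅) =
      ⊥-elim (K∩K'≡∅ u∈K (M¹.member-ideal K'∈M¹ v∈K' (proj₁ (proj₁ u⋖v))))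

  Jj⊆J∪Y : ∀ {x} → x ∈ Jj → x ∉ J → x ∈ Y
  Jj⊆J∪Y {x} x∈Jj x∉J with x ≟ j
  ... | yes refl = j∈Y
  ... | no x≢j with (K , K∈M¹ , K⊂Jj , x∈K , K∩J≡∅) ← member¹-disjoint-from-J x∈Jj x∉J x≢j =
    member¹-⊆Y K∈M¹ K⊂Jj K∩J≡∅ x∈K

  J∪Y⊆⇒Jj⊆ : ∀ {X} → J ⊆ X → Y ⊆ X → Jj ⊆ X
  J∪Y⊆⇒Jj⊆ J⊆X Y⊆X {x} x∈Jj with x ∈? J
  ... | yes x∈J = J⊆X x∈J
  ... | no x∉J = Y⊆X (Jj⊆J∪Y x∈Jj x∉J)

  laminar-outside-C : ∀ {A X} → C A → Vertex P A → X ∈ᴸ M² → ¬ C X → X ⊆ A ⊎ A ⊆ X ⊎ Disjoint X A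
  laminar-outside-C A∈C vA X∈M² X∉C = ¬Adj⇒laminar (M².vertex X∈M²) vA λ (vX , _ , crossing) →
    X∉C (C-closed A∈C (vA , vX , NontrivInter-sym crossing))

  Jj∈M² : Jj ∈ᴸ M²
  Jj∈M² = M².maximum-absorbs Jj-vertex uncrossed
    where
    uncrossed-outside-C : ∀ {X} → X ⊆ J ⊎ J ⊆ X ⊎ Disjoint X J → X ⊆ Y ⊎ Y ⊆ X ⊎ Disjoint X Y →
                          ¬ NontrivInter X Jj
    uncrossed-outside-C (inj₁ X⊆J) _ (_ , X⊈Jj , _) = X⊈Jj λ x∈X → J⊆Jj (X⊆J x∈X)
    uncrossed-outside-C _ (inj₁ X⊆Y) (_ , X⊈Jj , _) = X⊈Jj λ x∈X → Y⊆Jj (X⊆Y x∈X)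
    uncrossed-outside-C (inj₂ (inj₁ J⊆X)) (inj₂ (inj₁ Y⊆X)) (_ , _ , Jj⊈X) = Jj⊈X (J∪Y⊆⇒Jj⊆ J⊆X Y⊆X)
    uncrossed-outside-C (inj₂ (inj₁ J⊆X)) (inj₂ (inj₂ X∩Y≡∅)) _ = X∩Y≡∅ (J⊆X a∈J) a∈Y
    uncrossed-outside-C (inj₂ (inj₂ X∩J≡∅)) (inj₂ (inj₁ Y⊆X)) _ = X∩J≡∅ (Y⊆X a∈Y) a∈J
    uncrossed-outside-C (inj₂ (inj₂ X∩J≡∅)) (inj₂ (inj₂ X∩Y≡∅)) ((z , z∈X , z∈Jj) , _)
      with z ∈? J
    ... | yes z∈J = X∩J≡∅ z∈X z∈J
    ... | no z∉J = X∩Y≡∅ z∈X (Jj⊆J∪Y z∈Jj z∉J)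

    uncrossed : ∀ {X} → X ∈ᴸ M² → ¬ NontrivInter X Jj
    uncrossed {X} X∈M² crossing with C? X
    ... | yes X∈C = M¹.independent (C∩M²⊆M¹ X∈C X∈M²) Jj∈M¹ (M².vertex X∈M² , Jj-vertex , crossing)
    ... | no X∉C = uncrossed-outside-C (laminar-outside-C J∈C J-vertex X∈M² X∉C)
                                       (laminar-outside-C Y∈C Y-vertex X∈M² X∉C) crossing

  no-member²-between : ∀ {W} → W ∈ᴸ M² → J ⊂ W → W ⊂ Jj → ⊥
  no-member²-between {W} W∈M² J⊂W W⊂Jj@(_ , x , x∈Jj , x∉W) with C? W
  ... | yes W∈C = no-member¹-between (C∩M²⊆M¹ W∈C W∈M²) J⊂W W⊂Jj
  ... | no W∉C with laminar-outside-C Y∈C Y-vertex W∈M² W∉C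
  ...   | inj₁ W⊆Y = i∉Y (W⊆Y (proj₁ J⊂W i∈J))
  ...   | inj₂ (inj₁ Y⊆W) = x∉W (J∪Y⊆⇒Jj⊆ (proj₁ J⊂W) Y⊆W x∈Jj)
  ...   | inj₂ (inj₂ W∩Y≡∅) = W∩Y≡∅ (proj₁ J⊂W a∈J) a∈Y

  j∉μ² : ¬ InMu M² Jj j
  j∉μ² (W , W∈M² , W⊂Jj , j∈W) with C? W
  ... | yes W∈C = j∉member¹-below (C∩M²⊆M¹ W∈C W∈M²) W⊂Jj j∈W
  ... | no W∉C with laminar-outside-C J∈C J-vertex W∈M² W∉C
  ...   | inj₁ W⊆J = j∉J (W⊆J j∈W)
  ...   | inj₂ (inj₂ W∩J≡∅) = W∩J≡∅ (M².member-ideal W∈M² j∈W a≤j) a∈J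
  ...   | inj₂ (inj₁ J⊆W) with ⊆⇒⊂⊎≡ J⊆W
  ...     | inj₁ J⊂W = no-member²-between W∈M² J⊂W W⊂Jj
  ...     | inj₂ refl = j∉J j∈W

  -- The last edge of a Hasse path from a to i inside J comes from below, since i is maximal in Jj.
  lower-cover-in-Y : ∃ λ b → b ∈ Y × b ≤P i
  lower-cover-in-Y
    with (b , (b∈J , _ , b—i) , a→b) ← HassePath-last-edge (M¹.member-path J∈M¹ a∈J i∈J) a≢i
    with b—i
  ... | inj₁ ((i≤b , i≢b) , _) = ⊥-elim (i≢b (sym (i-maximal (J⊆Jj b∈J) i≤b)))
  ... | inj₂ ((b≤i , _) , _) = b , ∈Y⁺ (∈Y⁻ a∈Y ◅◅ HassePath-mono (p⊆q⇒p-x⊆q-x J⊆Jj) a→b) , b≤i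

  i∉μ² : ¬ InMu M² J i
  i∉μ² (W , W∈M² , W⊂J , i∈W) with C? W
  ... | yes W∈C = proj₁ (proj₂ LJ) (W , C∩M²⊆M¹ W∈C W∈M² , W⊂J , i∈W)
  ... | no W∉C with laminar-outside-C Y∈C Y-vertex W∈M² W∉C
  ...   | inj₁ W⊆Y = i∉Y (W⊆Y i∈W)
  ...   | inj₂ (inj₁ Y⊆W) = j∉J (proj₁ W⊂J (Y⊆W j∈Y))
  ...   | inj₂ (inj₂ W∩Y≡∅) with (b , b∈Y , b≤i) ← lower-cover-in-Y =
    W∩Y≡∅ (M².member-ideal W∈M² i∈W b≤i) b∈Y

  J-label² : Label M² J i
  J-label² = M².Label-intro nat _≤?_ J∈M² i∈J i∉μ²

  Jj-label² : Label M² Jj j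
  Jj-label² = M².Label-intro nat _≤?_ Jj∈M² j∈Jj j∉μ²

  parent² : ¬ ∃ λ k → i <F[ M² ] k × k <F[ M² ] j
  parent² ( _ , (_ , Jk , Ji∈ , Jk∈ , LJi , LJk , Ji⊂Jk)
          , (_ , _ , Jk'∈ , Jj'∈ , LJk' , LJj' , Jk'⊂Jj')) =
    no-member²-between Jk∈ J⊂Jk Jk⊂Jj
    where
    J⊂Jk : J ⊂ Jk
    J⊂Jk = subst (_⊂ Jk) (M².Label-injective Ji∈ J∈M² LJi J-label²) Ji⊂Jk
    Jk⊂Jj : Jk ⊂ Jj
    Jk⊂Jj = subst₂ _⊂_ (M².Label-injective Jk'∈ Jk∈ LJk' LJk)
                       (M².Label-injective Jj'∈ Jj∈M² LJj' Jj-label²) Jk'⊂Jj'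

module DescentTransfer
  {n : ℕ} (P : Poset n) (nat : NaturallyLabeled P)
  (C : Subset n → Set) (C-closed : ∀ {A B} → C A → Adj P A B → C B)
  {M¹ M² : List (Subset n)} (max¹ : MaxIndep P M¹) (max² : MaxIndep P M²)
  (C∩M²⊆M¹ : ∀ {X} → C X → X ∈ᴸ M² → X ∈ᴸ M¹) where

  open HassePaths P
  open IndependentSets P
  open DecMembership {A = Subset n} (≡-dec Data.Bool._≟_) using () renaming (_∈?_ to _∈ᴸ?_)

  Decisions : Set
  Decisions = (∀ a b → Dec (Poset._≤P_ P a b)) × (∀ X → Dec (C X)) ×
              (∀ S a x → Dec (HassePath S a x))

  -- These relations need not be decidable, but every conclusion of Des-transfer is stable,
  -- so deciding them may be assumed.
  ¬¬-decisions : ¬ ¬ Decisions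
  ¬¬-decisions k =
    ¬¬-∀-Fin (λ _ → ¬¬-∀-Fin λ _ → ¬¬-excluded-middle) λ ≤? →
    ¬¬-∀-Subset (λ _ → ¬¬-excluded-middle) λ C? →
    ¬¬-∀-Subset (λ _ → ¬¬-∀-Fin λ _ → ¬¬-∀-Fin λ _ → ¬¬-excluded-middle) λ path? →
    k (≤? , C? , path?)

  Des-transfer : ∀ {J i} → J ∈ᴸ M¹ → J ∈ᴸ M² → C J → Label M¹ J i → InDes M¹ i →
                 Label M² J i × InDes M² i
  Des-transfer {J} {i} J∈M¹ J∈M² J∈C LJ
               (j , ((Ji , Jj , Ji∈M¹ , Jj∈M¹ , LJi , LJj , Ji⊂Jj) , parent) , j<i) =
    J-label² , j , ((J , Jj , J∈M² , Jj∈M² , J-label² , Jj-label² , J⊂Jj) , parent²) , j<i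
    where
    J⊂Jj : J ⊂ Jj
    J⊂Jj = subst (_⊂ Jj) (Maximum.Label-injective max¹ Ji∈M¹ J∈M¹ LJi LJ) Ji⊂Jj

    module Core (d : Decisions) =
      ParentPreserved P nat (proj₁ d) C (proj₁ (proj₂ d)) C-closed (proj₂ (proj₂ d)) max¹ max² C∩M²⊆M¹
                      J∈M¹ J∈M² J∈C LJ Jj∈M¹ LJj J⊂Jj j<i parent

    classically : ∀ {A : Set} → (Decisions → A) → ¬ ¬ A
    classically f k = ¬¬-decisions (k ∘ f)

    J-label² : Label M² J i
    J-label² = Label-stable (proj₁ LJ) (classically Core.J-label²)

    Jj∈M² : Jj ∈ᴸ M²
    Jj∈M² = decidable-stable (Jj ∈ᴸ? M²) (classically Core.Jj∈M²)

    Jj-label² : Label M² Jj j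
    Jj-label² = Label-stable (proj₁ LJj) (classically Core.Jj-label²)

    parent² : ¬ ∃ λ k → i <F[ M² ] k × k <F[ M² ] j
    parent² between = classically Core.parent² λ ¬between → ¬between between

module ComponentTransfer
         {n : ℕ} (P : Poset n) (nat : NaturallyLabeled P) (J₀ : Subset n) {Mr M¹ M² : List (Subset n)}
         (max¹ : MaxIndep P M¹) (max² : MaxIndep P M²)
         (M¹∩C⇔Mr : ∀ J → (J ∈ᴸ M¹ × InComponent P J₀ J) ⇔ J ∈ᴸ Mr)
         (M²∩C⇔Mr : ∀ J → (J ∈ᴸ M² × InComponent P J₀ J) ⇔ J ∈ᴸ Mr) where

  open DescentTransfer P nat (InComponent P J₀) (λ J₀→A A—B → J₀→A ◅◅ (A—B ◅ ε)) max¹ max²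
         (λ {X} X∈C X∈M² → proj₁ (Equivalence.from (M¹∩C⇔Mr X) (Equivalence.to (M²∩C⇔Mr X) (X∈M² , X∈C))))

  transferred : ∀ {J i} → J ∈ᴸ Mr → Label M¹ J i → InDes M¹ i → Label M² J i × InDes M² i
  transferred {J} J∈Mr = Des-transfer J∈M¹ J∈M² J∈C
    where
    J∈M¹ : J ∈ᴸ M¹
    J∈M¹ = proj₁ (Equivalence.from (M¹∩C⇔Mr J) J∈Mr)
    J∈C : InComponent P J₀ J
    J∈C = proj₂ (Equivalence.from (M¹∩C⇔Mr J) J∈Mr)
    J∈M² : J ∈ᴸ M²
    J∈M² = proj₁ (Equivalence.from (M²∩C⇔Mr J) J∈Mr)

  DesR-transfer : ∀ i → InDesR Mr M¹ i → InDesR Mr M² i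
  DesR-transfer i (i∈Des , J , J∈Mr , LJ) =
    let (LJ² , i∈Des²) = transferred J∈Mr LJ i∈Des in i∈Des² , J , J∈Mr , LJ²

  DesBar-transfer : ∀ J → InDesBar Mr M¹ J → InDesBar Mr M² J
  DesBar-transfer J (J∈Mr , i , i∈DesR@(i∈Des , _) , LJ) =
    J∈Mr , i , DesR-transfer i i∈DesR , proj₁ (transferred J∈Mr LJ i∈Des)

theorem1p2 : (n : ℕ) (P : Poset n) → NaturallyLabeled P →
    (J₀ : Subset n) → Vertex P J₀ →
    (Mr : List (Subset n)) → MaxIndepIn P (InComponent P J₀) Mr →
    (M¹ M² : List (Subset n)) → MaxIndep P M¹ → MaxIndep P M² →
    (∀ J → (J ∈ᴸ M¹ × InComponent P J₀ J) ⇔ J ∈ᴸ Mr) →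
    (∀ J → (J ∈ᴸ M² × InComponent P J₀ J) ⇔ J ∈ᴸ Mr) →
    (∀ (i : Fin n) → InDesR Mr M¹ i ⇔ InDesR Mr M² i) ×
    (∀ J → InDesBar Mr M¹ J ⇔ InDesBar Mr M² J)
theorem1p2 n P nat J₀ _ Mr _ M¹ M² max¹ max² M¹∩C⇔Mr M²∩C⇔Mr =
  (λ i → mk⇔ (T₁₂.DesR-transfer i) (T₂₁.DesR-transfer i)) ,
  (λ J → mk⇔ (T₁₂.DesBar-transfer J) (T₂₁.DesBar-transfer J))
  where
  module T₁₂ = ComponentTransfer P nat J₀ max¹ max² M¹∩C⇔Mr M²∩C⇔Mr
  module T₂₁ = ComponentTransfer P nat J₀ max² max¹ M²∩C⇔Mr M¹∩C⇔Mr
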